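{- Let $G$ be a tournament and let $(X,Y,Z)$ be a partition of $V(G)$ such that $X\cup Y$, $Y\cup Z$ and $Z\cup X$ are all independent. Then for every $v\in V(G)$, either every cyclic triangle containing $v$ is an $XYZ$ triangle, or every cyclic triangle containing $v$ is an $XZY$ triangle.
   Context: A set of vertices is independent if it induces a transitive (acyclic) subtournament. A cyclic triangle is a set of three vertices $a,b,c$ with $a\to b\to c\to a$. An $XYZ$ triangle is a cyclic triangle consisting of $x\in X$, $y\in Y$, $z\in Z$ with $x\to y$, $y\to z$, $z\to x$. An $XZY$ triangle is a cyclic triangle consisting of $x\in X$, $y\in Y$, $z\in Z$ with $x\to z$, $z\to y$, $y\to x$. -}

module Defs where

open import Data.Nat using (ℕ)
open import Data.Fin using (Fin)
open import Data.Product using (_×_; Σ; _,_)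
open import Data.Sum using (_⊎_)
open import Data.Empty using (⊥)
open import Data.List using (List; []; _∷_)
open import Relation.Nullary using (¬_)
open import Relation.Binary.PropositionalEquality using (_≡_; _≢_)

record Tournament (n : ℕ) : Set₁ where
  field
    _⟶_     : Fin n → Fin n → Set
    irrefl  : ∀ u → ¬ (u ⟶ u)
    asym    : ∀ u v → u ⟶ v → ¬ (v ⟶ u)
    total   : ∀ u v → u ≢ v → (u ⟶ v) ⊎ (v ⟶ u)

-- labels of the three classes of a partition (X, Y, Z); a partition of V(G)
-- into three (possibly empty) classes is a function V(G) → Part
data Part : Set where
  X Y Z : Part

module _ {n : ℕ} (G : Tournament n) where
  open Tournament G

  data WalkIn (S : Fin n → Set) : Fin n → Fin n → Set where
    [] : ∀ {u} → S u → WalkIn S u u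
    _∷_ : ∀ {u v w} → S u → u ⟶ v → WalkIn S v w → WalkIn S u w

  -- S induces an acyclic subtournament: there is no directed cycle
  -- (closed directed walk with at least one edge) inside S.
  Independent : (Fin n → Set) → Set
  Independent S = ∀ {u v} → S u → u ⟶ v → WalkIn S v u → ⊥

  CyclicTriangle : Fin n → Fin n → Fin n → Set
  CyclicTriangle a b c = (a ⟶ b) × (b ⟶ c) × (c ⟶ a)

  In3 : Fin n → Fin n → Fin n → Fin n → Set
  In3 v a b c = (v ≡ a) ⊎ (v ≡ b) ⊎ (v ≡ c)

  SameSet3 : Fin n → Fin n → Fin n → Fin n → Fin n → Fin n → Set
  SameSet3 a b c x y z =
    (∀ v → In3 v a b c → In3 v x y z) × (∀ v → In3 v x y z → In3 v a b c)

  module _ (part : Fin n → Part) where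
    IsXYZ : Fin n → Fin n → Fin n → Set
    IsXYZ a b c = Σ (Fin n) λ x → Σ (Fin n) λ y → Σ (Fin n) λ z →
      (part x ≡ X) × (part y ≡ Y) × (part z ≡ Z) ×
      (x ⟶ y) × (y ⟶ z) × (z ⟶ x) × SameSet3 a b c x y z

    IsXZY : Fin n → Fin n → Fin n → Set
    IsXZY a b c = Σ (Fin n) λ x → Σ (Fin n) λ y → Σ (Fin n) λ z →
      (part x ≡ X) × (part y ≡ Y) × (part z ≡ Z) ×
      (x ⟶ z) × (z ⟶ y) × (y ⟶ x) × SameSet3 a b c x y z

    PartSet : Part → Fin n → Set
    PartSet A v = part v ≡ A

    Union : Part → Part → Fin n → Set
    Union A B v = (part v ≡ A) ⊎ (part v ≡ B)

module Submission where

-- Each union of two classes is acyclic, so the three vertices of a cyclic triangle lie in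
-- three different classes, and going around the triangle the classes advance either along
-- X → Y → Z → X (an XYZ triangle) or against it (an XZY triangle).  If v lay on a triangle
-- v → b → c → v of the first kind and on a triangle v → b' → c' → v of the second, then b, c'
-- share a class and so do c, b'; acyclicity of the two unions containing the class of v
-- forces c' → b and c → b', and then c → b' → c' → b → c is a directed 4-cycle in the union
-- of the other two classes.  Constructively, the alternative that holds is chosen by
-- searching the finite tournament for a cyclic triangle starting at v.

open import Defs
open import Data.Nat using (ℕ)
open import Data.Fin using (Fin)
open import Data.Fin.Properties using (any?) renaming (_≟_ to _≟ᶠ_)
open import Data.Sum using (_⊎_; inj₁; inj₂; [_,_]′; swap; fromInj₂)
open import Data.Product using (_×_; _,_; ∃₂)
open import Data.Empty using (⊥-elim)
open import Function using (_∘_; case_of_)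
open import Relation.Nullary using (¬_; Dec; yes; no)
open import Relation.Nullary.Decidable using (_×-dec_)
open import Relation.Unary using (Pred; _⊆_; _∪_)
open import Relation.Binary.Definitions using (Decidable)
open import Relation.Binary.PropositionalEquality using (_≡_; _≢_; refl; sym; trans)

next : Part → Part
next X = Y
next Y = Z
next Z = X

next-orbit : ∀ p q → q ≡ p ⊎ q ≡ next p ⊎ q ≡ next (next p)
next-orbit X X = inj₁ refl
next-orbit X Y = inj₂ (inj₁ refl)
next-orbit X Z = inj₂ (inj₂ refl)
next-orbit Y X = inj₂ (inj₂ refl)
next-orbit Y Y = inj₁ refl
next-orbit Y Z = inj₂ (inj₁ refl)
next-orbit Z X = inj₂ (inj₁ refl)
next-orbit Z Y = inj₂ (inj₂ refl)
next-orbit Z Z = inj₁ refl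

distinct-parts-orientation : ∀ {p q r} → p ≢ q → q ≢ r → r ≢ p →
  (q ≡ next p × r ≡ next (next p)) ⊎ (r ≡ next p × q ≡ next (next p))
distinct-parts-orientation {p} {q} {r} p≢q q≢r r≢p with next-orbit p q | next-orbit p r
... | inj₁ q≡p           | _                 = ⊥-elim (p≢q (sym q≡p))
... | _                  | inj₁ r≡p          = ⊥-elim (r≢p r≡p)
... | inj₂ (inj₁ q≡p⁺)   | inj₂ (inj₂ r≡p⁺⁺) = inj₁ (q≡p⁺ , r≡p⁺⁺)
... | inj₂ (inj₂ q≡p⁺⁺)  | inj₂ (inj₁ r≡p⁺)  = inj₂ (r≡p⁺ , q≡p⁺⁺)
... | inj₂ (inj₁ q≡p⁺)   | inj₂ (inj₁ r≡p⁺)  = ⊥-elim (q≢r (trans q≡p⁺ (sym r≡p⁺)))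
... | inj₂ (inj₂ q≡p⁺⁺)  | inj₂ (inj₂ r≡p⁺⁺) = ⊥-elim (q≢r (trans q≡p⁺⁺ (sym r≡p⁺⁺)))

module TournamentProperties {n : ℕ} (G : Tournament n) where
  open Tournament G

  ¬⟶⇒⟵ : ∀ {u w} → u ≢ w → ¬ (u ⟶ w) → w ⟶ u
  ¬⟶⇒⟵ {u} {w} u≢w u↛w = fromInj₂ (⊥-elim ∘ u↛w) (total u w u≢w)

  _⟶?_ : Decidable _⟶_
  u ⟶? w with u ≟ᶠ w
  ... | yes refl = no (irrefl u)
  ... | no u≢w   = [ yes , (λ w⟶u → no (asym w u w⟶u)) ]′ (total u w u≢w)

  cyclicTriangle? : ∀ a b c → Dec (CyclicTriangle G a b c)
  cyclicTriangle? a b c = (a ⟶? b) ×-dec (b ⟶? c) ×-dec (c ⟶? a)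

  cyclicTriangleFrom? : ∀ v → Dec (∃₂ λ b c → CyclicTriangle G v b c)
  cyclicTriangleFrom? v = any? λ b → any? λ c → cyclicTriangle? v b c

  rotate : ∀ {a b c} → CyclicTriangle G a b c → CyclicTriangle G b c a
  rotate (ab , bc , ca) = bc , ca , ab

  walkIn-map : ∀ {S T : Pred (Fin n) _} → S ⊆ T → ∀ {u w} → WalkIn G S u w → WalkIn G T u w
  walkIn-map S⊆T ([] u∈S)      = [] (S⊆T u∈S)
  walkIn-map S⊆T (_∷_ u∈S e p) = _∷_ (S⊆T u∈S) e (walkIn-map S⊆T p)

  independent-anti-mono : ∀ {S T : Pred (Fin n) _} → S ⊆ T → Independent G T → Independent G S
  independent-anti-mono S⊆T indT u∈S e p = indT (S⊆T u∈S) e (walkIn-map S⊆T p)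

  independent⇒¬cyclicTriangle : ∀ {S a b c} → Independent G S → S a → S b → S c →
    ¬ CyclicTriangle G a b c
  independent⇒¬cyclicTriangle indS a∈S b∈S c∈S (ab , bc , ca) =
    indS a∈S ab (_∷_ b∈S bc (_∷_ c∈S ca ([] a∈S)))

  independent⇒¬4-cycle : ∀ {S a b c d} → Independent G S → S a → S b → S c → S d →
    a ⟶ b → b ⟶ c → c ⟶ d → ¬ (d ⟶ a)
  independent⇒¬4-cycle indS a∈S b∈S c∈S d∈S ab bc cd da =
    indS a∈S ab (_∷_ b∈S bc (_∷_ c∈S cd (_∷_ d∈S da ([] a∈S))))

  ¬oppositeTriangles : ∀ {P Q R : Pred (Fin n) _} {v b c b' c'} →
    Independent G (P ∪ Q) → Independent G (P ∪ R) → Independent G (Q ∪ R) →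
    P v → Q b → R c → Q c' → R b' →
    CyclicTriangle G v b c → ¬ CyclicTriangle G v b' c'
  ¬oppositeTriangles {v = v} {b} {c} {b'} {c'} indPQ indPR indQR
    v∈P b∈Q c∈R c'∈Q b'∈R (vb , bc , cv) (vb' , b'c' , c'v) =
    independent⇒¬4-cycle indQR (inj₂ c∈R) (inj₂ b'∈R) (inj₁ c'∈Q) (inj₁ b∈Q) cb' b'c' c'b bc
    where
    c'b : c' ⟶ b
    c'b = ¬⟶⇒⟵ (λ { refl → asym v b vb c'v }) λ bc' →
      independent⇒¬cyclicTriangle indPQ (inj₁ v∈P) (inj₂ b∈Q) (inj₂ c'∈Q) (vb , bc' , c'v)
    cb' : c ⟶ b'
    cb' = ¬⟶⇒⟵ (λ { refl → asym v b' vb' cv }) λ b'c →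
      independent⇒¬cyclicTriangle indPR (inj₁ v∈P) (inj₂ b'∈R) (inj₂ c∈R) (vb' , b'c , cv)

  in₁ : ∀ {a b c} → In3 G a a b c
  in₁ = inj₁ refl

  in₂ : ∀ {a b c} → In3 G b a b c
  in₂ = inj₂ (inj₁ refl)

  in₃ : ∀ {a b c} → In3 G c a b c
  in₃ = inj₂ (inj₂ refl)

  sameSet3 : ∀ {a b c x y z} →
    In3 G a x y z → In3 G b x y z → In3 G c x y z →
    In3 G x a b c → In3 G y a b c → In3 G z a b c → SameSet3 G a b c x y z
  sameSet3 a∈ b∈ c∈ x∈ y∈ z∈ =
    (λ { _ (inj₁ refl) → a∈ ; _ (inj₂ (inj₁ refl)) → b∈ ; _ (inj₂ (inj₂ refl)) → c∈ }) ,
    (λ { _ (inj₁ refl) → x∈ ; _ (inj₂ (inj₁ refl)) → y∈ ; _ (inj₂ (inj₂ refl)) → z∈ })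

  sameSet3-trans : ∀ {a b c a' b' c' x y z} →
    SameSet3 G a b c a' b' c' → SameSet3 G a' b' c' x y z → SameSet3 G a b c x y z
  sameSet3-trans (to , from) (to' , from') = (λ v → to' v ∘ to v) , (λ v → from v ∘ from' v)

  sameSet3-rotate : ∀ {a b c} → SameSet3 G a b c b c a
  sameSet3-rotate = sameSet3 in₃ in₁ in₂ in₂ in₃ in₁

  RotationInvariant : (Fin n → Fin n → Fin n → Set) → Set
  RotationInvariant Q = ∀ {a b c} → Q b c a → Q a b c

  AllTrianglesThrough : Fin n → (Fin n → Fin n → Fin n → Set) → Set
  AllTrianglesThrough v Q = ∀ a b c → CyclicTriangle G a b c → In3 G v a b c → Q a b c

  allTrianglesThrough-byRotation : ∀ {Q} → RotationInvariant Q → ∀ v →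
    (∀ b c → CyclicTriangle G v b c → Q v b c) → AllTrianglesThrough v Q
  allTrianglesThrough-byRotation rot v Q-at-v a b c t (inj₁ refl)        = Q-at-v b c t
  allTrianglesThrough-byRotation rot v Q-at-v a b c t (inj₂ (inj₁ refl)) = rot (Q-at-v c a (rotate t))
  allTrianglesThrough-byRotation rot v Q-at-v a b c t (inj₂ (inj₂ refl)) =
    rot (rot (Q-at-v a b (rotate (rotate t))))

module Tripartite {n : ℕ} (G : Tournament n) (part : Fin n → Part) where
  open Tournament G
  open TournamentProperties G

  IsXYZ-resp : ∀ {a b c a' b' c'} → SameSet3 G a b c a' b' c' →
    IsXYZ G part a' b' c' → IsXYZ G part a b c
  IsXYZ-resp same (x , y , z , x∈X , y∈Y , z∈Z , xy , yz , zx , same') =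
    x , y , z , x∈X , y∈Y , z∈Z , xy , yz , zx , sameSet3-trans same same'

  IsXZY-resp : ∀ {a b c a' b' c'} → SameSet3 G a b c a' b' c' →
    IsXZY G part a' b' c' → IsXZY G part a b c
  IsXZY-resp same (x , y , z , x∈X , y∈Y , z∈Z , xz , zy , yx , same') =
    x , y , z , x∈X , y∈Y , z∈Z , xz , zy , yx , sameSet3-trans same same'

  IsXYZ-rotationInvariant : RotationInvariant (IsXYZ G part)
  IsXYZ-rotationInvariant = IsXYZ-resp sameSet3-rotate

  IsXZY-rotationInvariant : RotationInvariant (IsXZY G part)
  IsXZY-rotationInvariant = IsXZY-resp sameSet3-rotate

  Forward : Fin n → Fin n → Fin n → Set
  Forward a b c = part b ≡ next (part a) × part c ≡ next (next (part a))

  Backward : Fin n → Fin n → Fin n → Set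
  Backward a b c = Forward a c b

  forward⇒IsXYZ : ∀ {a b c} → CyclicTriangle G a b c → Forward a b c → IsXYZ G part a b c
  forward⇒IsXYZ {a} {b} {c} (ab , bc , ca) (b∈ , c∈) with part a in a∈
  ... | X = a , b , c , a∈ , b∈ , c∈ , ab , bc , ca , sameSet3 in₁ in₂ in₃ in₁ in₂ in₃
  ... | Y = c , a , b , c∈ , a∈ , b∈ , ca , ab , bc , sameSet3 in₂ in₃ in₁ in₃ in₁ in₂
  ... | Z = b , c , a , b∈ , c∈ , a∈ , bc , ca , ab , sameSet3 in₃ in₁ in₂ in₂ in₃ in₁

  backward⇒IsXZY : ∀ {a b c} → CyclicTriangle G a b c → Backward a b c → IsXZY G part a b c
  backward⇒IsXZY {a} {b} {c} (ab , bc , ca) (c∈ , b∈) with part a in a∈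
  ... | X = a , c , b , a∈ , c∈ , b∈ , ab , bc , ca , sameSet3 in₁ in₃ in₂ in₁ in₃ in₂
  ... | Y = b , a , c , b∈ , a∈ , c∈ , bc , ca , ab , sameSet3 in₂ in₁ in₃ in₂ in₁ in₃
  ... | Z = c , b , a , c∈ , b∈ , a∈ , ca , ab , bc , sameSet3 in₃ in₂ in₁ in₃ in₂ in₁

  module PairwiseIndependent
    (iXY : Independent G (Union G part X Y))
    (iYZ : Independent G (Union G part Y Z))
    (iZX : Independent G (Union G part Z X)) where

    independent-union : ∀ p q → Independent G (PartSet G part p ∪ PartSet G part q)
    independent-union X Y = iXY
    independent-union Y Z = iYZ
    independent-union Z X = iZX
    independent-union Y X = independent-anti-mono swap iXY
    independent-union Z Y = independent-anti-mono swap iYZ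
    independent-union X Z = independent-anti-mono swap iZX
    independent-union X X = independent-anti-mono [ inj₁ , inj₁ ]′ iXY
    independent-union Y Y = independent-anti-mono [ inj₁ , inj₁ ]′ iYZ
    independent-union Z Z = independent-anti-mono [ inj₁ , inj₁ ]′ iZX

    cyclicTriangle-parts-distinct : ∀ {a b c} → CyclicTriangle G a b c → part a ≢ part b
    cyclicTriangle-parts-distinct {a} {b} {c} t a≡b =
      independent⇒¬cyclicTriangle (independent-union (part a) (part c))
        (inj₁ refl) (inj₁ (sym a≡b)) (inj₂ refl) t

    cyclicTriangle-orientation : ∀ {a b c} → CyclicTriangle G a b c → Forward a b c ⊎ Backward a b c
    cyclicTriangle-orientation t = distinct-parts-orientation
      (cyclicTriangle-parts-distinct t)
      (cyclicTriangle-parts-distinct (rotate t))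
      (cyclicTriangle-parts-distinct (rotate (rotate t)))

    ¬oppositeOrientations : ∀ {v b c b' c'} →
      CyclicTriangle G v b c → Forward v b c → CyclicTriangle G v b' c' → ¬ Backward v b' c'
    ¬oppositeOrientations {v} t (b∈ , c∈) t' (c'∈ , b'∈) =
      ¬oppositeTriangles
        (independent-union p (next p))
        (independent-union p (next (next p)))
        (independent-union (next p) (next (next p)))
        refl b∈ c∈ c'∈ b'∈ t t'
      where p = part v

    forward-unique : ∀ {v b c b' c'} →
      CyclicTriangle G v b c → Forward v b c → CyclicTriangle G v b' c' → Forward v b' c'
    forward-unique t fwd t' with cyclicTriangle-orientation t'
    ... | inj₁ fwd' = fwd'
    ... | inj₂ bwd' = ⊥-elim (¬oppositeOrientations t fwd t' bwd')

    backward-unique : ∀ {v b c b' c'} →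
      CyclicTriangle G v b c → Backward v b c → CyclicTriangle G v b' c' → Backward v b' c'
    backward-unique t bwd t' with cyclicTriangle-orientation t'
    ... | inj₁ fwd' = ⊥-elim (¬oppositeOrientations t' fwd' t bwd)
    ... | inj₂ bwd' = bwd'

lemma2p3p4 : {n : ℕ} (G : Tournament n) (part : Fin n → Part) →
    Independent G (Union G part X Y) →
    Independent G (Union G part Y Z) →
    Independent G (Union G part Z X) →
    (v : Fin n) →
      ((a b c : Fin n) → CyclicTriangle G a b c → In3 G v a b c → IsXYZ G part a b c)
      ⊎ ((a b c : Fin n) → CyclicTriangle G a b c → In3 G v a b c → IsXZY G part a b c)
lemma2p3p4 G part iXY iYZ iZX v = case cyclicTriangleFrom? v of λ where
    (no ∄t) → inj₁ (allTrianglesThrough-byRotation IsXYZ-rotationInvariant v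
      λ b c t → ⊥-elim (∄t (b , c , t)))
    (yes (_ , _ , t)) → case cyclicTriangle-orientation t of λ where
      (inj₁ fwd) → inj₁ (allTrianglesThrough-byRotation IsXYZ-rotationInvariant v
        λ _ _ t' → forward⇒IsXYZ t' (forward-unique t fwd t'))
      (inj₂ bwd) → inj₂ (allTrianglesThrough-byRotation IsXZY-rotationInvariant v
        λ _ _ t' → backward⇒IsXZY t' (backward-unique t bwd t'))
  where
  open TournamentProperties G
  open Tripartite G part
  open PairwiseIndependent iXY iYZ iZX
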